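{- In the standing setup of the context, there is no edge of $G$ between a vertex $v_1\in\overline{V_1}$ and a vertex $v_2$ that is small or belongs to $\overline{V_2}$.
   Context: Loop-free multigraph: finite undirected graph without loops, multiple edges between distinct vertices allowed. The type of an edge joining $u,v$ is $\{u,v\}$; its multiplicity is the number of edges of that type; an edge/type is simple if its multiplicity is one and non-simple if at least two; a graph is simple if all edges are simple. Two vertices are adjacent if there is at least one edge between them. Double edge swap $(a_1,a_2)(a_3,a_4)$: remove two distinct edges of types $\{a_1,a_2\},\{a_3,a_4\}$ and add edges of types $\{a_2,a_3\},\{a_4,a_1\}$; admissible if the removed edges share no endpoint and not both are simple. Orders: fix finite $V$ and $d:V\to\mathbb{N}$, and a total order $<$ on $V$ with $d(u)<d(v)\Rightarrow u<v$. For $u_1>u_2$, $v_1>v_2$ set $\{u_1,u_2\}\le\{v_1,v_2\}$ iff $u_1<v_1$ or ($u_1=v_1$ and $u_2\le v_2$). For loop-free multigraphs on $V$ with degrees $d$: $G'<G$ iff $G$ is not simple and either the maximal non-simple type of $G$ is larger than all non-simple types of $G'$, or the maximal non-simple types of $G'$ and $G$ coincide and its multiplicity is strictly larger in $G$ than in $G'$. Standing setup: $G$ is a non-simple loop-free multigraph on $V$ with $\deg_G v=d(v)$ for all $v$, such that no finite sequence of admissible double edge swaps transforms $G$ into a graph $G'$ with $G'<G$. Let $\{u_1,u_2\}$, $u_1>u_2$, be the maximal non-simple type of $G$. Vertices other than $u_1,u_2$ are ordinary. For $i=1,2$, $V_i$ is the set of ordinary vertices adjacent to $u_i$ and $\overline{V_i}$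 the set of ordinary vertices not adjacent to $u_i$. An ordinary vertex is small if it is smaller than $u_1$ and large if it is larger than $u_1$. -}

module Defs where

open import Level using (0ℓ)
open import Data.Nat using (ℕ; zero; suc; _+_; _≤_; _<_)
open import Data.Fin using (Fin; _≟_)
open import Data.Vec using (sum; tabulate)
open import Data.Product using (_×_; _,_; ∃; ∃-syntax; Σ-syntax)
open import Data.Sum using (_⊎_)
open import Relation.Nullary using (¬_; yes; no)
open import Relation.Binary.Core using (Rel)
open import Relation.Binary.PropositionalEquality using (_≡_; _≢_)
open import Relation.Binary.Construct.Closure.ReflexiveTransitive using (Star)

-- A loop-free multigraph on the vertex set Fin n is represented by its
-- multiplicity function: Mult G u v = number of edges of type {u,v}.
Mult : ℕ → Set
Mult n = Fin n → Fin n → ℕ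

IsLoopFree : ∀ {n} → Mult n → Set
IsLoopFree {n} G = (∀ u v → G u v ≡ G v u) × (∀ v → G v v ≡ 0)

deg : ∀ {n} → Mult n → Fin n → ℕ
deg G v = sum (tabulate (G v))

IsSimple : ∀ {n} → Mult n → Set
IsSimple G = ∀ u v → G u v ≤ 1

ind : ∀ {n} → Fin n → Fin n → Fin n → Fin n → ℕ
ind u v a b with u ≟ a | v ≟ b | u ≟ b | v ≟ a
... | yes _ | yes _ | _ | _ = 1
... | _ | _ | yes _ | yes _ = 1
... | _ | _ | _ | _ = 0

-- Admissible double edge swap (a1,a2)(a3,a4) turning G into G':
-- remove an edge of type {a1,a2} and one of type {a3,a4} (sharing no
-- endpoint, not both simple), add edges of types {a2,a3} and {a4,a1}.
-- The pointwise equation forces G a1 a2 ≥ 1 and G a3 a4 ≥ 1.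
AdmSwap : ∀ {n} → Mult n → Mult n → Set
AdmSwap {n} G G' = ∃[ a1 ] ∃[ a2 ] ∃[ a3 ] ∃[ a4 ]
  ( a1 ≢ a2 × a1 ≢ a3 × a1 ≢ a4 × a2 ≢ a3 × a2 ≢ a4 × a3 ≢ a4
  × (2 ≤ G a1 a2 ⊎ 2 ≤ G a3 a4)
  × (∀ u v → G' u v + ind u v a1 a2 + ind u v a3 a4
           ≡ G u v + ind u v a2 a3 + ind u v a4 a1))

Swaps : ∀ {n} → Mult n → Mult n → Set
Swaps = Star AdmSwap

module _ {n : ℕ} (_≺_ : Rel (Fin n) 0ℓ) where

  -- strict order on types {v1,v2} (v1 ≻ v2) < {u1,u2} (u1 ≻ u2)
  TypeLt : Fin n → Fin n → Fin n → Fin n → Set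
  TypeLt v1 v2 u1 u2 = v1 ≺ u1 ⊎ (v1 ≡ u1 × v2 ≺ u2)

  TypeLe : Fin n → Fin n → Fin n → Fin n → Set
  TypeLe v1 v2 u1 u2 = v1 ≺ u1 ⊎ (v1 ≡ u1 × (v2 ≺ u2 ⊎ v2 ≡ u2))

  IsMaxNonSimple : Mult n → Fin n → Fin n → Set
  IsMaxNonSimple G u1 u2 =
    u2 ≺ u1 × 2 ≤ G u1 u2 ×
    (∀ v1 v2 → v2 ≺ v1 → 2 ≤ G v1 v2 → TypeLe v1 v2 u1 u2)

  GraphLt : Mult n → Mult n → Set
  GraphLt G' G = ∃[ u1 ] ∃[ u2 ] (IsMaxNonSimple G u1 u2 ×
    ( (∀ v1 v2 → v2 ≺ v1 → 2 ≤ G' v1 v2 → TypeLt v1 v2 u1 u2)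
    ⊎ (IsMaxNonSimple G' u1 u2 × G' u1 u2 < G u1 u2)))

-- Swap an edge of the maximal non-simple type {u1,u2} against an edge {v1,v2}
-- via (u1,u2)(v2,v1). The multiplicity of {u1,u2} drops by one, and of the two
-- new types {v1,u1} was absent before (v1 ∉ V1), while {u2,v2} was either absent
-- (v2 ∉ V2) or lies strictly below {u1,u2} (v2 small). So the swapped graph is
-- smaller than G, contradicting the minimality of G.
module Submission where

open import Defs
open import Level using (0ℓ)
open import Data.Nat using (ℕ; zero; suc; _+_; _∸_; _≤_; _<_; z≤n; s≤s; s≤s⁻¹; _≤?_)
open import Data.Nat.Properties
  using (+-assoc; +-comm; m∸n≤m; m∸n+n≡m; m≤n+m; ≤-trans; n>0⇒n≢0; ∸-monoʳ-<)
open import Data.Fin using (Fin; _≟_)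
open import Data.Product using (_×_; _,_; proj₁; proj₂; ∃-syntax)
open import Data.Sum using (_⊎_; inj₁; inj₂)
open import Data.Empty using (⊥-elim)
open import Relation.Nullary using (¬_; yes; no)
open import Relation.Binary.Core using (Rel)
open import Relation.Binary.Structures using (IsStrictTotalOrder)
open import Relation.Binary.PropositionalEquality
  using (_≡_; _≢_; refl; sym; trans; subst; ≢-sym; module ≡-Reasoning)
open import Relation.Binary.Construct.Closure.ReflexiveTransitive using (ε; _◅_)

module _ {n : ℕ} where

  SameType : (u v a b : Fin n) → Set
  SameType u v a b = (u ≡ a × v ≡ b) ⊎ (u ≡ b × v ≡ a)

  data IndSpec (u v a b : Fin n) : ℕ → Set where
    same  : SameType u v a b → IndSpec u v a b 1
    other : ¬ SameType u v a b → IndSpec u v a b 0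

  ind-spec : ∀ u v a b → IndSpec u v a b (ind u v a b)
  ind-spec u v a b with u ≟ a | v ≟ b | u ≟ b | v ≟ a
  ... | yes u≡a | yes v≡b | _       | _       = same (inj₁ (u≡a , v≡b))
  ... | no _    | _       | yes u≡b | yes v≡a = same (inj₂ (u≡b , v≡a))
  ... | yes _   | no _    | yes u≡b | yes v≡a = same (inj₂ (u≡b , v≡a))
  ... | no u≢a  | _       | no u≢b  | _       =
    other λ { (inj₁ (u≡a , _)) → u≢a u≡a ; (inj₂ (u≡b , _)) → u≢b u≡b }
  ... | no u≢a  | _       | yes _   | no v≢a  =
    other λ { (inj₁ (u≡a , _)) → u≢a u≡a ; (inj₂ (_ , v≡a)) → v≢a v≡a }
  ... | yes _   | no v≢b  | no u≢b  | _       =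
    other λ { (inj₁ (_ , v≡b)) → v≢b v≡b ; (inj₂ (u≡b , _)) → u≢b u≡b }
  ... | yes _   | no v≢b  | yes _   | no v≢a  =
    other λ { (inj₁ (_ , v≡b)) → v≢b v≡b ; (inj₂ (_ , v≡a)) → v≢a v≡a }

  ind-same : ∀ a b → ind a b a b ≡ 1
  ind-same a b with ind a b a b | ind-spec a b a b
  ... | _ | same _   = refl
  ... | _ | other ¬s = ⊥-elim (¬s (inj₁ (refl , refl)))

  ind-other : ∀ {u v a b} → ¬ SameType u v a b → ind u v a b ≡ 0
  ind-other {u} {v} {a} {b} ¬s with ind u v a b | ind-spec u v a b
  ... | _ | same s  = ⊥-elim (¬s s)
  ... | _ | other _ = refl

  ¬SameType-fst : ∀ {u v a b} → u ≢ a → u ≢ b → ¬ SameType u v a b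
  ¬SameType-fst u≢a _   (inj₁ (u≡a , _)) = u≢a u≡a
  ¬SameType-fst _   u≢b (inj₂ (u≡b , _)) = u≢b u≡b

  ¬SameType-snd : ∀ {u v a b} → v ≢ a → v ≢ b → ¬ SameType u v a b
  ¬SameType-snd _   v≢b (inj₁ (_ , v≡b)) = v≢b v≡b
  ¬SameType-snd v≢a _   (inj₂ (_ , v≡a)) = v≢a v≡a

  SameType-disjoint : ∀ {u v a b c d} → a ≢ c → a ≢ d →
                      SameType u v a b → ¬ SameType u v c d
  SameType-disjoint a≢c a≢d (inj₁ (refl , _)) (inj₁ (refl , _)) = a≢c refl
  SameType-disjoint a≢c a≢d (inj₁ (refl , _)) (inj₂ (refl , _)) = a≢d refl
  SameType-disjoint a≢c a≢d (inj₂ (_ , refl)) (inj₁ (_ , refl)) = a≢d refl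
  SameType-disjoint a≢c a≢d (inj₂ (_ , refl)) (inj₂ (_ , refl)) = a≢c refl

  SameType-mult : ∀ {G : Mult n} → IsLoopFree G →
                  ∀ {u v a b} → SameType u v a b → G u v ≡ G a b
  SameType-mult _               (inj₁ (refl , refl)) = refl
  SameType-mult (symmetric , _) (inj₂ (refl , refl)) = symmetric _ _

  -- The truncated subtraction is exact as soon as both removed edges exist
  -- (removed≤mult); G u v comes last so that vanishing indicators reduce away.
  swapEdges : Mult n → (a1 a2 a3 a4 : Fin n) → Mult n
  swapEdges G a1 a2 a3 a4 u v =
    (ind u v a2 a3 + ind u v a4 a1 + G u v) ∸ (ind u v a1 a2 + ind u v a3 a4)

  module _ {G : Mult n} (lf : IsLoopFree G) {a1 a2 a3 a4 : Fin n} where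

    removed≤mult : a1 ≢ a3 → a1 ≢ a4 → 1 ≤ G a1 a2 → 1 ≤ G a3 a4 →
                   ∀ u v → ind u v a1 a2 + ind u v a3 a4 ≤ G u v
    removed≤mult a1≢a3 a1≢a4 G₁₂ G₃₄ u v
      with ind u v a1 a2 | ind-spec u v a1 a2 | ind u v a3 a4 | ind-spec u v a3 a4
    ... | _ | same s  | _ | same t  = ⊥-elim (SameType-disjoint a1≢a3 a1≢a4 s t)
    ... | _ | same s  | _ | other _ = subst (1 ≤_) (sym (SameType-mult lf s)) G₁₂
    ... | _ | other _ | _ | same t  = subst (1 ≤_) (sym (SameType-mult lf t)) G₃₄
    ... | _ | other _ | _ | other _ = z≤n

    swapEdges-admissible :
      a1 ≢ a2 → a1 ≢ a3 → a1 ≢ a4 → a2 ≢ a3 → a2 ≢ a4 → a3 ≢ a4 →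
      2 ≤ G a1 a2 → 1 ≤ G a3 a4 → AdmSwap G (swapEdges G a1 a2 a3 a4)
    swapEdges-admissible a1≢a2 a1≢a3 a1≢a4 a2≢a3 a2≢a4 a3≢a4 G₁₂ G₃₄ =
      a1 , a2 , a3 , a4 , a1≢a2 , a1≢a3 , a1≢a4 , a2≢a3 , a2≢a4 , a3≢a4 ,
      inj₁ G₁₂ , balance
      where
      open ≡-Reasoning
      balance : ∀ u v → swapEdges G a1 a2 a3 a4 u v + ind u v a1 a2 + ind u v a3 a4
                        ≡ G u v + ind u v a2 a3 + ind u v a4 a1
      balance u v = begin
        swapEdges G a1 a2 a3 a4 u v + ind u v a1 a2 + ind u v a3 a4
          ≡⟨ +-assoc (swapEdges G a1 a2 a3 a4 u v) _ _ ⟩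
        swapEdges G a1 a2 a3 a4 u v + (ind u v a1 a2 + ind u v a3 a4)
          ≡⟨ m∸n+n≡m (≤-trans (removed≤mult a1≢a3 a1≢a4 (≤-trans (s≤s z≤n) G₁₂) G₃₄ u v)
                              (m≤n+m (G u v) _)) ⟩
        ind u v a2 a3 + ind u v a4 a1 + G u v
          ≡⟨ +-comm (ind u v a2 a3 + ind u v a4 a1) (G u v) ⟩
        G u v + (ind u v a2 a3 + ind u v a4 a1)
          ≡⟨ sym (+-assoc (G u v) _ _) ⟩
        G u v + ind u v a2 a3 + ind u v a4 a1
          ∎

    swapEdges-decreases : a1 ≢ a2 → a1 ≢ a3 → a1 ≢ a4 → a2 ≢ a4 → 1 ≤ G a1 a2 →
                          swapEdges G a1 a2 a3 a4 a1 a2 < G a1 a2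
    swapEdges-decreases a1≢a2 a1≢a3 a1≢a4 a2≢a4 G₁₂
      rewrite ind-same a1 a2
            | ind-other (¬SameType-fst {v = a2} a1≢a3 a1≢a4)
            | ind-other (¬SameType-fst {v = a2} a1≢a2 a1≢a3)
            | ind-other (¬SameType-snd {u = a1} a2≢a4 (≢-sym a1≢a2))
      = ∸-monoʳ-< (s≤s z≤n) G₁₂

    swapEdges-nonSimple : a2 ≢ a4 → a2 ≢ a1 → ∀ {u v} → 2 ≤ swapEdges G a1 a2 a3 a4 u v →
                          2 ≤ G u v ⊎ (1 ≤ G u v × (SameType u v a2 a3 ⊎ SameType u v a4 a1))
    swapEdges-nonSimple a2≢a4 a2≢a1 {u} {v} 2≤G'
      with ≤-trans 2≤G' (m∸n≤m _ (ind u v a1 a2 + ind u v a3 a4))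
    ... | 2≤X with ind u v a2 a3 | ind-spec u v a2 a3 | ind u v a4 a1 | ind-spec u v a4 a1
    ... | _ | same s  | _ | same t  = ⊥-elim (SameType-disjoint a2≢a4 a2≢a1 s t)
    ... | _ | same s  | _ | other _ = inj₂ (s≤s⁻¹ 2≤X , inj₁ s)
    ... | _ | other _ | _ | same t  = inj₂ (s≤s⁻¹ 2≤X , inj₂ t)
    ... | _ | other _ | _ | other _ = inj₁ 2≤X

module _ {n : ℕ} {_≺_ : Rel (Fin n) 0ℓ} {G G' : Mult n} {u1 u2 : Fin n} where

  graphLt-byDecrease :
    IsMaxNonSimple _≺_ G u1 u2 → G' u1 u2 < G u1 u2 →
    (∀ a b → b ≺ a → 2 ≤ G' a b → TypeLe _≺_ a b u1 u2) →
    GraphLt _≺_ G' G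
  graphLt-byDecrease max@(u2≺u1 , _) decrease below with 2 ≤? G' u1 u2
  ... | yes nonSimple = u1 , u2 , max , inj₂ ((u2≺u1 , nonSimple , below) , decrease)
  ... | no simple = u1 , u2 , max , inj₁ λ a b b≺a 2≤G' → strict (below a b b≺a 2≤G') 2≤G'
    where
    strict : ∀ {a b} → TypeLe _≺_ a b u1 u2 → 2 ≤ G' a b → TypeLt _≺_ a b u1 u2
    strict (inj₁ a≺u1)                _ = inj₁ a≺u1
    strict (inj₂ (a≡u1 , inj₁ b≺u2))  _ = inj₂ (a≡u1 , b≺u2)
    strict (inj₂ (refl , inj₂ refl)) 2≤G' = ⊥-elim (simple 2≤G')

module _ {n : ℕ} {_≺_ : Rel (Fin n) 0ℓ} {G : Mult n} (lf : IsLoopFree G)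
         {u1 u2 v1 v2 : Fin n} where

  swapEdges-nonSimple-≤max :
    IsMaxNonSimple _≺_ G u1 u2 → u2 ≢ v1 → u2 ≢ u1 →
    G u1 v1 ≡ 0 → v2 ≺ u1 ⊎ G u2 v2 ≡ 0 →
    ∀ a b → b ≺ a → 2 ≤ swapEdges G u1 u2 v2 v1 a b → TypeLe _≺_ a b u1 u2
  swapEdges-nonSimple-≤max (u2≺u1 , _ , maximal) u2≢v1 u2≢u1 G₁₁≡0 v2-small-or-∉V₂
                           a b b≺a 2≤G'
    with swapEdges-nonSimple lf u2≢v1 u2≢u1 2≤G'
  ... | inj₁ 2≤G = maximal a b b≺a 2≤G
  ... | inj₂ (1≤G , inj₂ t) =
    ⊥-elim (n>0⇒n≢0 1≤G (trans (SameType-mult lf t) (trans (proj₁ lf v1 u1) G₁₁≡0)))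
  ... | inj₂ (1≤G , inj₁ s) with v2-small-or-∉V₂
  ...   | inj₂ G₂₂≡0 = ⊥-elim (n>0⇒n≢0 1≤G (trans (SameType-mult lf s) G₂₂≡0))
  ...   | inj₁ v2≺u1 with s
  ...     | inj₁ (refl , refl) = inj₁ u2≺u1
  ...     | inj₂ (refl , refl) = inj₁ v2≺u1

lemma5p3 : (n : ℕ) (d : Fin n → ℕ) (_≺_ : Rel (Fin n) 0ℓ)
    → IsStrictTotalOrder _≡_ _≺_
    → (∀ u v → d u < d v → u ≺ v)
    → (G : Mult n) → IsLoopFree G → (∀ v → deg G v ≡ d v)
    → ¬ IsSimple G
    → ¬ (∃[ G' ] (Swaps G G' × GraphLt _≺_ G' G))
    → (u1 u2 : Fin n) → IsMaxNonSimple _≺_ G u1 u2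
    → (v1 v2 : Fin n)
    → v1 ≢ u1 → v1 ≢ u2 → G u1 v1 ≡ 0
    → v2 ≢ u1 → v2 ≢ u2 → (v2 ≺ u1 ⊎ G u2 v2 ≡ 0)
    → G v1 v2 ≡ 0
lemma5p3 n _ _≺_ sto _ G lf _ _ minimal u1 u2 max@(u2≺u1 , 2≤G₁₂ , _) v1 v2
         v1≢u1 v1≢u2 G₁₁≡0 v2≢u1 v2≢u2 v2-small-or-∉V₂ with G v1 v2 in G₁₂≡
... | zero  = refl
... | suc _ = ⊥-elim (minimal (G' , swap ◅ ε , graphLt-byDecrease max decrease below))
  where
  u1≢u2 : u1 ≢ u2
  u1≢u2 u1≡u2 = IsStrictTotalOrder.irrefl sto (sym u1≡u2) u2≺u1
  1≤G₁₂ : 1 ≤ G v1 v2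
  1≤G₁₂ rewrite G₁₂≡ = s≤s z≤n
  v2≢v1 : v2 ≢ v1
  v2≢v1 refl = n>0⇒n≢0 1≤G₁₂ (proj₂ lf v2)
  G' : Mult n
  G' = swapEdges G u1 u2 v2 v1
  swap : AdmSwap G G'
  swap = swapEdges-admissible lf u1≢u2 (≢-sym v2≢u1) (≢-sym v1≢u1) (≢-sym v2≢u2)
           (≢-sym v1≢u2) v2≢v1 2≤G₁₂ (subst (1 ≤_) (proj₁ lf v1 v2) 1≤G₁₂)
  decrease : G' u1 u2 < G u1 u2
  decrease = swapEdges-decreases lf u1≢u2 (≢-sym v2≢u1) (≢-sym v1≢u1) (≢-sym v1≢u2)
               (≤-trans (s≤s z≤n) 2≤G₁₂)
  below : ∀ a b → b ≺ a → 2 ≤ G' a b → TypeLe _≺_ a b u1 u2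
  below = swapEdges-nonSimple-≤max lf max (≢-sym v1≢u2) (≢-sym u1≢u2) G₁₁≡0 v2-small-or-∉V₂
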